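{- Let $I=\{B\subseteq\{l,r\}^\star: B\text{ has no infinite antichain}\}$ and, for each integer $k\geq 1$, $I_k=\{B\subseteq\{l,r\}^\star: B\text{ has no antichain of cardinal greater than }k\}$. Then $I=\bigcup_{k\geq 1}I_k$.
   Context: An antichain in $\{l,r\}^\star$ is a set of words pairwise incomparable for the prefix order. -}

module Defs where

open import Level using (0ℓ)
open import Data.Nat using (ℕ; suc; _≥_)
open import Data.Fin using (Fin)
open import Data.List using (List; _++_)
open import Data.Product using (Σ; ∃; _×_)
open import Relation.Nullary using (¬_)
open import Relation.Binary.PropositionalEquality using (_≡_; _≢_)

data Letter : Set where
  l r : Letter

Word : Set
Word = List Letter

Subset : Set₁
Subset = Word → Set

_≼_ : Word → Word → Set
u ≼ v = ∃ λ w → u ++ w ≡ v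

Incomparable : Word → Word → Set
Incomparable u v = ¬ (u ≼ v) × ¬ (v ≼ u)

-- An antichain in B indexed by a type X: pairwise incomparable, all in B
-- (incomparability of distinct indices forces injectivity, so the
--  image has the cardinality of X).
IsAntichainIn : {X : Set} → Subset → (X → Word) → Set
IsAntichainIn {X} B f = ((x : X) → B (f x)) × ((x y : X) → x ≢ y → Incomparable (f x) (f y))

NoInfiniteAntichain : Subset → Set
NoInfiniteAntichain B = ¬ (Σ (ℕ → Word) λ f → IsAntichainIn B f)

-- B has no antichain of cardinal greater than k
-- (equivalently: no antichain with k+1 elements)
NoAntichainAbove : ℕ → Subset → Set
NoAntichainAbove k B = ¬ (Σ (Fin (suc k) → Word) λ f → IsAntichainIn B f)

InI : Subset → Set
InI = NoInfiniteAntichain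

InUnionIk : Subset → Set
InUnionIk B = ∃ λ k → k ≥ 1 × NoAntichainAbove k B

-- The bounded direction is immediate: an infinite antichain restricts to
-- antichains of every finite size.  For the converse we argue classically.
-- Call B unbounded when it contains (list-)antichains of every length.
--   * Counting: an antichain of length ≥ 2 avoids the empty word, so it
--     splits into the words beginning with l and those beginning with r;
--     hence if B is unbounded then so is B / l or B / r (its residual by a
--     letter).
--   * Forks: descending along unbounded residuals while the opposite branch
--     is empty must stop, since B contains two incomparable words; so an
--     unbounded B has a fork: a word c and a letter a with a word of B below
--     c (flip a) and B still unbounded below c a.
--   * Iterating forks yields prefixes p₀ ≼ p₁ ≼ …, each emitting a word of B
--     that branches off the later prefixes; the emitted words form an
--     infinite antichain.

module Submission where

open import Defs
open import Level using (0ℓ)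
open import Axiom.ExcludedMiddle using (ExcludedMiddle)
open import Axiom.DoubleNegationElimination using (em⇒dne)
open import Function.Bundles using (_⇔_; mk⇔)
open import Function.Base using (_∘_)
open import Function.Definitions using (Injective)

open import Data.Nat using (ℕ; zero; suc; _+_; _≤_; _<_; z≤n; s≤s; _≤′_; ≤′-refl; ≤′-step)
open import Data.Nat.Properties using (<-cmp; <⇒<′; +-suc; +-mono-≤; ≤-trans; ≤-reflexive; 1+n≰n; ≰⇒>; m≤n+m; module ≤-Reasoning)
open import Data.Fin using (Fin; toℕ)
open import Data.Fin.Properties using (toℕ-injective)
open import Data.List using (List; []; _∷_; _++_; length; tabulate)
open import Data.List.Properties using (++-assoc; ++-identityʳ; length-tabulate; ∷-injectiveˡ; ∷-injectiveʳ)
open import Data.List.Relation.Unary.All as All using (All; []; _∷_)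
open import Data.List.Relation.Unary.All.Properties using (tabulate⁺)
open import Data.List.Relation.Unary.AllPairs as AllPairs using (AllPairs; []; _∷_)
open import Data.List.Relation.Unary.AllPairs.Properties as AllPairsₚ using ()
open import Data.Product using (Σ; ∃; _×_; _,_; proj₁; proj₂)
open import Data.Sum using (_⊎_; inj₁; inj₂)
open import Data.Empty using (⊥-elim)
open import Relation.Nullary using (¬_; yes; no)
open import Relation.Binary using (Rel; Symmetric; DecidableEquality; tri<; tri≈; tri>)
open import Relation.Binary.PropositionalEquality using (_≡_; _≢_; refl; sym; cong; subst)
open import Relation.Unary using (_⊆_)

flip : Letter → Letter
flip l = r
flip r = l

flip-≢ : (a : Letter) → flip a ≢ a
flip-≢ l ()
flip-≢ r ()

_≟_ : DecidableEquality Letter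
l ≟ l = yes refl
l ≟ r = no λ ()
r ≟ l = no λ ()
r ≟ r = yes refl

same-or-flip : (a c : Letter) → c ≡ a ⊎ c ≡ flip a
same-or-flip l l = inj₁ refl
same-or-flip l r = inj₂ refl
same-or-flip r l = inj₂ refl
same-or-flip r r = inj₁ refl

≼-refl : ∀ {u} → u ≼ u
≼-refl {u} = [] , ++-identityʳ u

≼-trans : ∀ {u v w} → u ≼ v → v ≼ w → u ≼ w
≼-trans {u} (s , refl) (t , refl) = s ++ t , sym (++-assoc u s t)

≼-++ : ∀ u v → u ≼ (u ++ v)
≼-++ u v = v , refl

Incomparable-sym : ∀ {u v} → Incomparable u v → Incomparable v u
Incomparable-sym (u⋠v , v⋠u) = v⋠u , u⋠v

Incomparable-uncons : ∀ {a u v} → Incomparable (a ∷ u) (a ∷ v) → Incomparable u v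
Incomparable-uncons {a} (au⋠av , av⋠au) =
  (λ { (w , e) → au⋠av (w , cong (a ∷_) e) }) , (λ { (w , e) → av⋠au (w , cong (a ∷_) e) })

Incomparable-cons : ∀ {a u v} → Incomparable u v → Incomparable (a ∷ u) (a ∷ v)
Incomparable-cons (u⋠v , v⋠u) =
  (λ { (w , e) → u⋠v (w , ∷-injectiveʳ e) }) , (λ { (w , e) → v⋠u (w , ∷-injectiveʳ e) })

diverge : ∀ {a b} c s t → a ≢ b → Incomparable (c ++ a ∷ s) (c ++ b ∷ t)
diverge [] s t a≢b =
  (λ { (_ , e) → a≢b (∷-injectiveˡ e) }) , (λ { (_ , e) → a≢b (sym (∷-injectiveˡ e)) })
diverge (_ ∷ c) s t a≢b = Incomparable-cons (diverge c s t a≢b)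

fork-incomparable : ∀ {a} c w {v} → (c ++ a ∷ []) ≼ v → Incomparable (c ++ flip a ∷ w) v
fork-incomparable {a} c w (t , refl) =
  subst (Incomparable (c ++ flip a ∷ w)) (sym (++-assoc c (a ∷ []) t))
        (diverge c w t (flip-≢ a))

Residual : Subset → Word → Subset
Residual S p v = S (p ++ v)

_/_ : Subset → Letter → Subset
S / a = Residual S (a ∷ [])

residual-++ : ∀ {S} p q {v} → Residual (Residual S p) q v → Residual S (p ++ q) v
residual-++ {S} p q {v} = subst S (sym (++-assoc p q v))

Antichain : Subset → List Word → Set
Antichain S xs = All S xs × AllPairs Incomparable xs

Wide : Subset → ℕ → Set
Wide S n = ∃ λ xs → n ≤ length xs × Antichain S xs

Unbounded : Subset → Set
Unbounded S = ∀ n → Wide S n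

wide-weaken : ∀ {S m n} → m ≤ n → Wide S n → Wide S m
wide-weaken m≤n (xs , n≤ , ac) = xs , ≤-trans m≤n n≤ , ac

unbounded-⊆ : ∀ {S T} → S ⊆ T → Unbounded S → Unbounded T
unbounded-⊆ S⊆T u n with u n
... | xs , n≤ , mem , pairs = xs , n≤ , All.map S⊆T mem , pairs

incomparable-pair : ∀ {S} → Unbounded S → ∃ λ x → ∃ λ y → S x × S y × Incomparable x y
incomparable-pair u with u 2
... | [] , () , _
... | _ ∷ [] , s≤s () , _
... | x ∷ y ∷ _ , _ , (sx ∷ sy ∷ _) , ((x∥y ∷ _) ∷ _) = x , y , sx , sy , x∥y

branch : Letter → List Word → List Word
branch a [] = []
branch a ([] ∷ xs) = branch a xs
branch a ((b ∷ w) ∷ xs) with b ≟ a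
... | yes _ = w ∷ branch a xs
... | no _ = branch a xs

branch-All : ∀ {P : Word → Set} a {xs} → All P xs → All (P ∘ (a ∷_)) (branch a xs)
branch-All a [] = []
branch-All a {[] ∷ _} (_ ∷ ps) = branch-All a ps
branch-All a {(b ∷ _) ∷ _} (p ∷ ps) with b ≟ a
... | yes refl = p ∷ branch-All a ps
... | no _ = branch-All a ps

branch-AllPairs : ∀ {R : Rel Word 0ℓ} a {xs} → AllPairs R xs →
                  AllPairs (λ u v → R (a ∷ u) (a ∷ v)) (branch a xs)
branch-AllPairs a [] = []
branch-AllPairs a {[] ∷ _} (_ ∷ ps) = branch-AllPairs a ps
branch-AllPairs a {(b ∷ _) ∷ _} (p ∷ ps) with b ≟ a
... | yes refl = branch-All a p ∷ branch-AllPairs a ps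
... | no _ = branch-AllPairs a ps

branch-antichain : ∀ {S} a {xs} → Antichain S xs → Antichain (S / a) (branch a xs)
branch-antichain a (mem , pairs) =
  branch-All a mem , AllPairs.map Incomparable-uncons (branch-AllPairs a pairs)

-- Only a singleton antichain can contain the empty word, so every other
-- element lies in one of the two branches.
branch-length : ∀ {xs} → AllPairs Incomparable xs →
                length xs ≤ suc (length (branch l xs) + length (branch r xs))
branch-length [] = z≤n
branch-length {[] ∷ []} _ = s≤s z≤n
branch-length {[] ∷ y ∷ _} ((ε∥y ∷ _) ∷ _) = ⊥-elim (proj₁ ε∥y (y , refl))
branch-length {(l ∷ _) ∷ _} (_ ∷ ps) = s≤s (branch-length ps)
branch-length {(r ∷ _) ∷ _} (_ ∷ ps) =
  s≤s (≤-trans (branch-length ps) (≤-reflexive (sym (+-suc _ _))))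

split-bound : ∀ {S nₗ nᵣ} →
              (∀ {xs} → Antichain (S / l) xs → length xs < nₗ) →
              (∀ {xs} → Antichain (S / r) xs → length xs < nᵣ) →
              ¬ Wide S (nₗ + nᵣ)
split-bound {nₗ = nₗ} {nᵣ} boundₗ boundᵣ (xs , n≤ , ac) = 1+n≰n (begin
  suc (suc (kₗ + kᵣ))  ≡⟨ cong suc (+-suc kₗ kᵣ) ⟨
  suc kₗ + suc kᵣ      ≤⟨ +-mono-≤ (boundₗ (branch-antichain l ac)) (boundᵣ (branch-antichain r ac)) ⟩
  nₗ + nᵣ              ≤⟨ n≤ ⟩
  length xs            ≤⟨ branch-length (proj₂ ac) ⟩
  suc (kₗ + kᵣ)        ∎)
  where
  open ≤-Reasoning
  kₗ kᵣ : ℕ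
  kₗ = length (branch l xs)
  kᵣ = length (branch r xs)

record Fork (S : Subset) : Set where
  field
    stem : Word
    dir : Letter
    tail : Word
    member : Residual S stem (flip dir ∷ tail)
    unbounded : Unbounded (Residual S stem / dir)

fork-cons : ∀ {S} a → Fork (S / a) → Fork S
fork-cons a F = record
  { stem = a ∷ stem ; dir = dir ; tail = tail ; member = member ; unbounded = unbounded }
  where open Fork F

pairwise-of-< : ∀ {A : Set} {R : Rel A 0ℓ} {f : ℕ → A} → Symmetric R →
                (∀ {i j} → i < j → R (f i) (f j)) → ∀ i j → i ≢ j → R (f i) (f j)
pairwise-of-< sym-R R< i j i≢j with <-cmp i j
... | tri< i<j _ _ = R< i<j
... | tri≈ _ i≡j _ = ⊥-elim (i≢j i≡j)
... | tri> _ _ j<i = sym-R (R< j<i)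

antichain-reindex : ∀ {X Y : Set} {S} {f : X → Word} (g : Y → X) →
                    Injective _≡_ _≡_ g → IsAntichainIn S f → IsAntichainIn S (f ∘ g)
antichain-reindex g g-inj (mem , inc) = mem ∘ g , λ x y x≢y → inc (g x) (g y) (x≢y ∘ g-inj)

wide-of-fin : ∀ {S n} {f : Fin n → Word} → IsAntichainIn S f → Wide S n
wide-of-fin {f = f} (mem , inc) =
  tabulate f , ≤-reflexive (sym (length-tabulate f)) ,
  tabulate⁺ mem , AllPairsₚ.tabulate⁺ (λ {i} {j} → inc i j)

only-branch : ∀ {S : Subset} {a c : Letter} {x : Word} →
              ¬ (∃ λ (w : Word) → S (flip a ∷ w)) → S (c ∷ x) → c ≡ a
only-branch {a = a} {c} none sc with same-or-flip a c
... | inj₁ c≡a = c≡a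
... | inj₂ refl = ⊥-elim (none (_ , sc))

module Classical (em : ExcludedMiddle 0ℓ) where

  dne : {P : Set} → ¬ ¬ P → P
  dne = em⇒dne em

  ¬∀⇒∃¬ : {P : ℕ → Set} → ¬ (∀ n → P n) → ∃ λ n → ¬ P n
  ¬∀⇒∃¬ ¬∀ = dne λ ¬∃ → ¬∀ λ n → dne λ ¬Pn → ¬∃ (n , ¬Pn)

  bounded : ∀ {S} → ¬ Unbounded S → ∃ λ n → ∀ {xs} → Antichain S xs → length xs < n
  bounded ¬u with ¬∀⇒∃¬ ¬u
  ... | n , ¬wide = n , λ {xs} ac → ≰⇒> λ n≤ → ¬wide (xs , n≤ , ac)

  unbounded-branch : ∀ {S} → Unbounded S → ∃ λ a → Unbounded (S / a)
  unbounded-branch {S} u with em {Unbounded (S / l)} | em {Unbounded (S / r)}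
  ... | yes uₗ | _ = l , uₗ
  ... | no _ | yes uᵣ = r , uᵣ
  ... | no ¬uₗ | no ¬uᵣ =
    let (nₗ , boundₗ) = bounded ¬uₗ ; (nᵣ , boundᵣ) = bounded ¬uᵣ
    in ⊥-elim (split-bound boundₗ boundᵣ (u (nₗ + nᵣ)))

  -- Follow unbounded residuals until the opposite branch is inhabited; the
  -- incomparable words x, y of S guarantee that this happens before x ends.
  fork : ∀ {S} x {y} → Unbounded S → S x → S y → Incomparable x y → Fork S
  fork [] {y} _ _ _ x∥y = ⊥-elim (proj₁ x∥y (y , refl))
  fork (c ∷ x) {[]} _ _ _ x∥y = ⊥-elim (proj₂ x∥y (c ∷ x , refl))
  fork {S} (c ∷ x) {d ∷ y} u sx sy x∥y with unbounded-branch u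
  ... | a , uₐ with em {∃ λ (w : Word) → S (flip a ∷ w)}
  ... | yes (w , sw) =
    record { stem = [] ; dir = a ; tail = w ; member = sw ; unbounded = uₐ }
  ... | no none with only-branch {S} {a} {c} {x} none sx | only-branch {S} {a} {d} {y} none sy
  ... | refl | refl = fork-cons a (fork x uₐ sx sy (Incomparable-uncons x∥y))

  fork-of : ∀ {S} → Unbounded S → Fork S
  fork-of u = let (x , y , sx , sy , x∥y) = incomparable-pair u in fork x u sx sy x∥y

  module Forks (B : Subset) where

    State : Set
    State = Σ Word (Unbounded ∘ Residual B)

    prefix : State → Word
    prefix = proj₁

    fork-at : (s : State) → Fork (Residual B (prefix s))
    fork-at (_ , u) = fork-of u

    fork-point : State → Word
    fork-point s = prefix s ++ Fork.stem (fork-at s)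

    emit : State → Word
    emit s = fork-point s ++ flip dir ∷ tail
      where open Fork (fork-at s)

    emit-∈ : (s : State) → B (emit s)
    emit-∈ s = residual-++ {B} (prefix s) stem member
      where open Fork (fork-at s)

    step : State → State
    step s = fork-point s ++ dir ∷ [] ,
             unbounded-⊆ (λ {v} h → residual-++ {B} (fork-point s) (dir ∷ [])
                                      (residual-++ {B} (prefix s) stem {dir ∷ v} h))
                         unbounded
      where open Fork (fork-at s)

    prefix-≼-beyond-fork : (s : State) (x : Word) → prefix s ≼ (fork-point s ++ x)
    prefix-≼-beyond-fork s x = ≼-trans (≼-++ (prefix s) _) (≼-++ (fork-point s) x)

    run : State → ℕ → State
    run s zero = s
    run s (suc i) = step (run s i)

    run-≼ : ∀ s {i j} → i ≤′ j → prefix (run s i) ≼ prefix (run s j)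
    run-≼ s ≤′-refl = ≼-refl
    run-≼ s {j = suc j} (≤′-step i≤j) = ≼-trans (run-≼ s i≤j) (prefix-≼-beyond-fork (run s j) _)

    -- A later emitted word lies on the unbounded side of every earlier fork.
    emit-incomparable : ∀ s {i j} → i < j → Incomparable (emit (run s i)) (emit (run s j))
    emit-incomparable s {i} {j} i<j =
      fork-incomparable (fork-point (run s i)) (Fork.tail (fork-at (run s i)))
        (≼-trans (run-≼ s (<⇒<′ i<j)) (prefix-≼-beyond-fork (run s j) _))

  infinite-antichain : ∀ {B} → Unbounded B → Σ (ℕ → Word) (IsAntichainIn B)
  infinite-antichain {B} u =
    e , (λ i → emit-∈ (run s₀ i)) ,
    pairwise-of-< {R = Incomparable} {f = e} Incomparable-sym (emit-incomparable s₀)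
    where
    open Forks B
    s₀ : State
    s₀ = [] , u
    e : ℕ → Word
    e i = emit (run s₀ i)

  -- Without a bound k ≥ 1, every size n is reached (take k = n + 1).
  unbounded-without-bound : ∀ {B} → ¬ InUnionIk B → Unbounded B
  unbounded-without-bound {B} ¬bounded n = dne λ ¬wide →
    ¬bounded (suc n , s≤s z≤n ,
              λ { (_ , ac) → ¬wide (wide-weaken (m≤n+m n 2) (wide-of-fin {S = B} ac)) })

lemma4p6 : ExcludedMiddle 0ℓ → (B : Subset) → InI B ⇔ InUnionIk B
lemma4p6 em B = mk⇔ bounded-of-noInfinite noInfinite-of-bounded
  where
  open Classical em

  bounded-of-noInfinite : InI B → InUnionIk B
  bounded-of-noInfinite noInfinite = dne λ ¬bounded →
    noInfinite (infinite-antichain {B} (unbounded-without-bound ¬bounded))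

  noInfinite-of-bounded : InUnionIk B → InI B
  noInfinite-of-bounded (_ , _ , noAbove) (f , ac) =
    noAbove (f ∘ toℕ , antichain-reindex {S = B} toℕ toℕ-injective ac)
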